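{- Let $\sigma\in\mathfrak{B}_m$ and $\tau\in\mathfrak{B}_n$ be signed permutations, and let $i,j,p,q$ be nonnegative integers with $i+j\le m$ and $p+q\le n$ such that $\sigma_k<0$ for $k\le i$ and for $k>m-j$, $\sigma_k>0$ for $i<k\le m-j$, and $\tau_k<0$ for $k\le p$ and for $k>n-q$, $\tau_k>0$ for $p<k\le n-q$ (i.e. $\sigma=(\smile^i,\bar\sigma,\smile^j)$ and $\tau=(\smile^p,\bar\tau,\smile^q)$ with $\smile$ denoting negative entries). If $j>1$ or $q>1$, then $\varphi_2(\sigma\overline{\star}_{ -1}\tau)=0$.
   Context: $\mathfrak{B}_n$ is the set of permutations $\pi$ of $\{ -n,\dots,n\}$ with $\pi(-i)=-\pi(i)$, written as words $\pi_1\cdots\pi_n$, $\mathfrak{B}_0=\{\imath\}$; $\mathfrak{S}_n$ those with all entries positive. $\mathrm{st}$ of a word $a_1\cdots a_n$ over $\mathbb{Z}\setminus\{0\}$ is the unique $b_1\cdots b_n\in\mathfrak{B}_n$ with $\mathrm{sign}(b_i)=\mathrm{sign}(a_i)$ and $|b_i|<|b_j|$ whenever $|a_i|<|a_j|$ or ($|a_i|=|a_j|$, $i<j$), extended linearly. On words over $\mathbb{Z}\setminus\{0\}$, $\star_{ -1}$ is the bilinear product with the empty word as identity and $au\star_{ -1}bv=a(u\star_{ -1}bv)+b(au\star_{ -1}v)-(a\bullet b)(u\star_{ -1}v)$, where $a\bullet b=a$ if $a,b<0$ and $0$ otherwise. For $\sigma\in\mathfrak{B}_m,\tau\in\mathfrak{B}_n$,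 $\sigma\overline{\star}_{ -1}\tau=\mathrm{st}(\sigma\star_{ -1}\tau[m])$, where $\tau[m]$ replaces positive letters $i$ by $i+m$ and negative letters $-i$ by $-(i+m)$. The linear map $\varphi_2:\bigoplus_n\mathbf{k}\mathfrak{B}_n\to\bigoplus_n\mathbf{k}\mathfrak{S}_n$ is defined on $\pi\in\mathfrak{B}_n$ by $\varphi_2(\pi)=(-1)^j\mathrm{st}(\bar\pi)$ if there are $i\ge0$, $j\in\{0,1\}$ with $i+j<n$ such that $\pi_k<0$ for $k\le i$ and for $k>n-j$, and $\pi_k>0$ for $i<k\le n-j$ ($\bar\pi$ being the subword of positive entries), and $\varphi_2(\pi)=\delta_{\pi,\imath}$ otherwise. -}

module Defs where

open import Data.Nat as ℕ using (ℕ; zero; suc; _∸_; _<_; _≤_)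
open import Data.Integer as ℤ using (ℤ; +_; -[1+_]; ∣_∣; sign; _◃_)
open import Data.List using (List; []; _∷_; _++_; [_]; map; length; filter; take; drop; concatMap; upTo; sum)
open import Data.List.Properties using (≡-dec)
open import Data.List.Relation.Unary.All using (All; all?)
open import Data.List.Relation.Binary.Permutation.Propositional using (_↭_)
open import Data.Product using (_×_; _,_; proj₁; proj₂)
open import Relation.Binary.PropositionalEquality using (_≡_)
open import Relation.Nullary using (Dec; yes; no; _×-dec_)

-- Letters of words are integers (intended nonzero).  Words = List ℤ.
Word : Set
Word = List ℤ

IsSignedPerm : ℕ → Word → Set
IsSignedPerm n π = length π ≡ n × map ∣_∣ π ↭ map suc (upTo n)

-- Formal ℤ-linear combinations of words (free ℤ-module), as lists of terms.
LC : Set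
LC = List (ℤ × Word)

scale : ℤ → LC → LC
scale c = map (λ t → (c ℤ.* proj₁ t , proj₂ t))

pre : ℤ → LC → LC
pre a = map (λ t → (proj₁ t , a ∷ proj₂ t))

coeff : Word → LC → ℤ
coeff w [] = + 0
coeff w ((c , v) ∷ L) with ≡-dec ℤ._≟_ v w
... | yes _ = c ℤ.+ coeff w L
... | no  _ = coeff w L

IsZero : LC → Set
IsZero L = ∀ w → coeff w L ≡ + 0

-- a • b = a if a,b < 0, and 0 otherwise; (a•b)(u ⋆ v) as a combination
bulletPre : ℤ → ℤ → LC → LC
bulletPre a b L with a ℤ.<? + 0 | b ℤ.<? + 0
... | yes _ | yes _ = pre a L
... | _     | _     = []

star : Word → Word → LC
star [] v = [ (+ 1 , v) ]
star (a ∷ u) [] = [ (+ 1 , a ∷ u) ]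
star (a ∷ u) (b ∷ v) =
  pre a (star u (b ∷ v)) ++ pre b (star (a ∷ u) v)
    ++ scale (ℤ.- + 1) (bulletPre a b (star u v))

shiftL : ℕ → ℤ → ℤ
shiftL m x = sign x ◃ (∣ x ∣ ℕ.+ m)

shiftW : ℕ → Word → Word
shiftW m = map (shiftL m)

stAux : Word → Word → Word → Word
stAux seen [] full = []
stAux seen (a ∷ rest) full =
  (sign a ◃ suc (length (filter (λ x → ∣ x ∣ ℕ.<? ∣ a ∣) full)
                 ℕ.+ length (filter (λ x → ∣ x ∣ ℕ.≟ ∣ a ∣) seen)))
  ∷ stAux (seen ++ [ a ]) rest full

st : Word → Word
st w = stAux [] w w

stLC : LC → LC
stLC = map (λ t → (proj₁ t , st (proj₂ t)))

starBar : ℕ → Word → Word → LC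
starBar m σ τ = stLC (star σ (shiftW m τ))

Neg Pos : ℤ → Set
Neg x = x ℤ.< + 0
Pos x = + 0 ℤ.< x

Shape : ℕ → ℕ → ℕ → Word → Set
Shape n i j π =
  All Neg (take i π) × All Pos (take (n ∸ (i ℕ.+ j)) (drop i π)) × All Neg (drop (n ∸ j) π)

shape? : ∀ n i j π → Dec (Shape n i j π)
shape? n i j π =
  all? (λ x → x ℤ.<? + 0) (take i π)
  ×-dec all? (λ x → + 0 ℤ.<? x) (take (n ∸ (i ℕ.+ j)) (drop i π))
  ×-dec all? (λ x → x ℤ.<? + 0) (drop (n ∸ j) π)

posPart : Word → Word
posPart = filter (λ x → + 0 ℤ.<? x)

φ₂term : ℕ → ℕ → Word → LC
φ₂term i j π with i ℕ.+ j ℕ.<? length π | shape? (length π) i j π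
... | yes _ | yes _ = [ ((ℤ.- + 1) ℤ.^ j , st (posPart π)) ]
... | _     | _     = []

δı : Word → LC
δı [] = [ (+ 1 , []) ]
δı (_ ∷ _) = []

-- At most one (i,j) can fit (i is the length of the maximal
-- negative prefix, j is determined by the sign of the last letter), and π = ı never
-- fits, so φ₂(π) = Σ_{fitting (i,j)} (-1)^j st(π̄) + δ_{π,ı}.
φ₂ : Word → LC
φ₂ π = concatMap (λ i → φ₂term i 0 π ++ φ₂term i 1 π) (upTo (length π)) ++ δı π

φ₂LC : LC → LC
φ₂LC = concatMap (λ t → scale (proj₁ t) (φ₂ (proj₂ t)))

-- On a standardised word st w (w nonempty, letters of distinct absolute values) φ₂
-- depends only on the sign pattern of w and on its non-negative subword w⁺: it is
-- (−1)^j st(w⁺) when the signs read −^i +^k −^j with k ≥ 1 and j ≤ 1, and 0 otherwise.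
-- Hence the coefficient of x in φ₂(σ ⋆̄ τ) is Σ c_w (−1)^j(w) [x = st w⁺] over the words
-- w of σ ⋆ τ[m]. Let j > 1. If σ has a positive letter, its signs contain + − −, and so do
-- those of every word of σ ⋆ τ[m], which contain the sign pattern of σ as a subsequence:
-- every term vanishes. Otherwise σ is entirely negative, all words w share w⁺ = τ[m]⁺, and
-- the signed count Σ c_w (−1)^j(w) vanishes, by induction along the recursion defining ⋆₋₁.
-- The case q > 1 is symmetric, since this signed count is symmetric in the two factors.

module Submission where

open import Defs
open import Data.Bool using (Bool; true; false; _∧_; if_then_else_)
open import Data.Bool.Properties using (∧-comm)
open import Data.Empty using (⊥-elim)
open import Data.Integer as ℤ using (ℤ; +_; -[1+_]; -_; _+_; _-_; _*_; _^_; ∣_∣; sign; _◃_)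
import Data.Integer.Properties as ℤ
open import Data.List using (List; []; _∷_; _++_; [_]; map; filter; length; take; drop; concatMap; upTo; applyUpTo)
open import Data.List.Membership.Propositional using (_∈_)
open import Data.List.Properties
  using (≡-dec; ++-identityʳ; ++-assoc; map-++; map-upTo; concatMap-map; concatMap-cong; filter-none; filter-accept;
         filter-reject; take-all; drop-all; take++drop≡id; drop-drop; length-drop)
import Data.List.Relation.Binary.Pointwise as Pointwise
open import Data.List.Relation.Binary.Permutation.Propositional as ↭ using (_↭_; ↭-refl; ↭-prep; ↭-trans; ↭-sym; ↭-reflexive)
open import Data.List.Relation.Binary.Permutation.Propositional.Properties using (shift; All-resp-↭)
open import Data.List.Relation.Binary.Sublist.Propositional using (_⊆_; []; _∷_; _∷ʳ_; ⊆-refl; minimum; lookup)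
open import Data.List.Relation.Binary.Sublist.Propositional.Properties using (filter⁺; length-mono-≤)
open import Data.List.Relation.Ternary.Interleaving.Propositional using (Interleaving; []; consˡ; consʳ; left; right)
open import Data.List.Relation.Unary.All as All using (All; []; _∷_)
import Data.List.Relation.Unary.All.Properties as All
open import Data.List.Relation.Unary.AllPairs as AllPairs using ([]; _∷_)
open import Data.List.Relation.Unary.Any using (here; there)
open import Data.List.Relation.Unary.Unique.Propositional using (Unique)
import Data.List.Relation.Unary.Unique.Propositional.Properties as Unique
open import Data.Nat as ℕ using (ℕ; zero; suc; z≤n; s≤s; _∸_; _≤_; _<_)
import Data.Nat.Properties as ℕ
open import Data.Product using (_×_; _,_; proj₁; proj₂; ∃)
import Data.Sign as Sign
open import Data.Sum using (_⊎_; inj₁; inj₂)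
open import Function using (_∘_; _⇔_; mk⇔; Equivalence; case_of_)
open import Relation.Binary.Definitions using (tri<; tri≈; tri>)
open import Relation.Binary.PropositionalEquality
  using (_≡_; _≢_; refl; sym; trans; cong; cong₂; subst; module ≡-Reasoning)
open import Relation.Nullary using (yes; no; ¬_; _×-dec_)
open import Relation.Unary using (Decidable)

isNeg : ℤ → Bool
isNeg (+ _)    = false
isNeg -[1+ _ ] = true

signs : Word → List Bool
signs = map isNeg

-- weight (run leading w) is the sign (−1)^j of the summand of φ₂ (st w), or 0 if it has none.
data Phase : Set where
  leading middle trailing dead : Phase

step : Phase → Bool → Phase
step leading  true  = leading
step leading  false = middle
step middle   true  = trailing
step middle   false = middle
step trailing _     = dead
step dead     _     = dead

steps : Phase → List Bool → Phase
steps s []       = s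
steps s (b ∷ bs) = steps (step s b) bs

run : Phase → Word → Phase
run s w = steps s (signs w)

weight : Phase → ℤ
weight middle   = + 1
weight trailing = - + 1
weight _        = + 0

steps-dead : ∀ bs → steps dead bs ≡ dead
steps-dead []       = refl
steps-dead (_ ∷ bs) = steps-dead bs

steps-dead-middle⇒trailing : ∀ bs → steps middle bs ≡ dead → steps trailing bs ≡ dead
steps-dead-middle⇒trailing []       ()
steps-dead-middle⇒trailing (_ ∷ bs) _ = steps-dead bs

steps-dead-leading⇒middle : ∀ bs → steps leading bs ≡ dead → steps middle bs ≡ dead
steps-dead-leading⇒middle []          ()
steps-dead-leading⇒middle (true ∷ bs)  d = steps-dead-middle⇒trailing bs (steps-dead-leading⇒middle bs d)
steps-dead-leading⇒middle (false ∷ bs) d = d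

steps-step-dead : ∀ s b bs → steps s bs ≡ dead → steps (step s b) bs ≡ dead
steps-step-dead leading  true  bs d = d
steps-step-dead leading  false bs d = steps-dead-leading⇒middle bs d
steps-step-dead middle   true  bs d = steps-dead-middle⇒trailing bs d
steps-step-dead middle   false bs d = d
steps-step-dead trailing _     bs _ = steps-dead bs
steps-step-dead dead     _     bs _ = steps-dead bs

steps-dead-⊆ : ∀ s {bs cs} → bs ⊆ cs → steps s bs ≡ dead → steps s cs ≡ dead
steps-dead-⊆ s                 []             d = d
steps-dead-⊆ s {bs}            (c ∷ʳ bs⊆cs)   d = steps-dead-⊆ (step s c) bs⊆cs (steps-step-dead s c bs d)
steps-dead-⊆ s {b ∷ _} {.b ∷ _} (refl ∷ bs⊆cs) d = steps-dead-⊆ (step s b) bs⊆cs d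

weigh : Phase → LC → ℤ
weigh s []            = + 0
weigh s ((c , w) ∷ L) = c * weight (run s w) + weigh s L

weigh-++ : ∀ s L M → weigh s (L ++ M) ≡ weigh s L + weigh s M
weigh-++ s []            M = sym (ℤ.+-identityˡ _)
weigh-++ s ((c , w) ∷ L) M = begin
  c * weight (run s w) + weigh s (L ++ M)             ≡⟨ cong (_+_ (c * weight (run s w))) (weigh-++ s L M) ⟩
  c * weight (run s w) + (weigh s L + weigh s M)      ≡⟨ ℤ.+-assoc (c * weight (run s w)) (weigh s L) (weigh s M) ⟨
  c * weight (run s w) + weigh s L + weigh s M        ∎
  where open ≡-Reasoning

weigh-pre : ∀ s a L → weigh s (pre a L) ≡ weigh (step s (isNeg a)) L
weigh-pre s a []            = refl
weigh-pre s a ((c , w) ∷ L) = cong (_+_ (c * weight (run (step s (isNeg a)) w))) (weigh-pre s a L)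

weigh-scale : ∀ s c L → weigh s (scale c L) ≡ c * weigh s L
weigh-scale s c []            = sym (ℤ.*-zeroʳ c)
weigh-scale s c ((d , w) ∷ L) = begin
  c * d * weight (run s w) + weigh s (scale c L)      ≡⟨ cong₂ _+_ (ℤ.*-assoc c d _) (weigh-scale s c L) ⟩
  c * (d * weight (run s w)) + c * weigh s L          ≡⟨ ℤ.*-distribˡ-+ c _ _ ⟨
  c * (d * weight (run s w) + weigh s L)              ∎
  where open ≡-Reasoning

weigh-bulletPre : ∀ s a b L →
  weigh s (bulletPre a b L) ≡ (if isNeg a ∧ isNeg b then weigh (step s true) L else + 0)
weigh-bulletPre s (+ _)    _        L = refl
weigh-bulletPre s -[1+ _ ] (+ _)    L = refl
weigh-bulletPre s -[1+ m ] -[1+ _ ] L = weigh-pre s -[1+ m ] L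

weigh⋆ : Phase → Word → Word → ℤ
weigh⋆ s u v = weigh s (star u v)

mergeTerm : Phase → ℤ → ℤ → Word → Word → ℤ
mergeTerm s a b u v = if isNeg a ∧ isNeg b then weigh⋆ (step s true) u v else + 0

weigh⋆-∷ : ∀ s a u b v → weigh⋆ s (a ∷ u) (b ∷ v) ≡
  weigh⋆ (step s (isNeg a)) u (b ∷ v) + weigh⋆ (step s (isNeg b)) (a ∷ u) v - mergeTerm s a b u v
weigh⋆-∷ s a u b v = begin
  weigh s (pre a L₁ ++ pre b L₂ ++ scale (- + 1) (bulletPre a b L₃))
    ≡⟨ weigh-++ s (pre a L₁) _ ⟩
  weigh s (pre a L₁) + weigh s (pre b L₂ ++ scale (- + 1) (bulletPre a b L₃))
    ≡⟨ cong (_+_ (weigh s (pre a L₁))) (weigh-++ s (pre b L₂) _) ⟩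
  weigh s (pre a L₁) + (weigh s (pre b L₂) + weigh s (scale (- + 1) (bulletPre a b L₃)))
    ≡⟨ cong₂ (λ x y → x + (weigh s (pre b L₂) + y)) (weigh-pre s a L₁) (weigh-scale s (- + 1) (bulletPre a b L₃)) ⟩
  weigh⋆ (step s (isNeg a)) u (b ∷ v) + (weigh s (pre b L₂) + - + 1 * weigh s (bulletPre a b L₃))
    ≡⟨ cong₂ (λ x y → weigh⋆ (step s (isNeg a)) u (b ∷ v) + (x + y))
         (weigh-pre s b L₂) (trans (ℤ.-1*i≡-i (weigh s (bulletPre a b L₃))) (cong -_ (weigh-bulletPre s a b L₃))) ⟩
  weigh⋆ (step s (isNeg a)) u (b ∷ v) + (weigh⋆ (step s (isNeg b)) (a ∷ u) v - mergeTerm s a b u v)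
    ≡⟨ ℤ.+-assoc (weigh⋆ (step s (isNeg a)) u (b ∷ v)) (weigh⋆ (step s (isNeg b)) (a ∷ u) v) (- mergeTerm s a b u v) ⟨
  weigh⋆ (step s (isNeg a)) u (b ∷ v) + weigh⋆ (step s (isNeg b)) (a ∷ u) v - mergeTerm s a b u v ∎
  where
  open ≡-Reasoning
  L₁ = star u (b ∷ v)
  L₂ = star (a ∷ u) v
  L₃ = star u v

weigh⋆-[]ˡ : ∀ s v → weigh⋆ s [] v ≡ weight (run s v)
weigh⋆-[]ˡ s v = trans (ℤ.+-identityʳ _) (ℤ.*-identityˡ _)

star-[]ʳ : ∀ u → star u [] ≡ star [] u
star-[]ʳ []      = refl
star-[]ʳ (_ ∷ _) = refl

-- star is not symmetric (a • b = a), but a merged letter is negative either way.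
weigh⋆-comm : ∀ s u v → weigh⋆ s u v ≡ weigh⋆ s v u
weigh⋆-comm s []      v       = cong (weigh s) (sym (star-[]ʳ v))
weigh⋆-comm s (a ∷ u) []      = refl
weigh⋆-comm s (a ∷ u) (b ∷ v) = begin
  weigh⋆ s (a ∷ u) (b ∷ v)
    ≡⟨ weigh⋆-∷ s a u b v ⟩
  weigh⋆ (step s (isNeg a)) u (b ∷ v) + weigh⋆ (step s (isNeg b)) (a ∷ u) v - mergeTerm s a b u v
    ≡⟨ cong₂ _-_ (trans (cong₂ _+_ (weigh⋆-comm _ u (b ∷ v)) (weigh⋆-comm _ (a ∷ u) v))
                        (ℤ.+-comm (weigh⋆ (step s (isNeg a)) (b ∷ v) u) (weigh⋆ (step s (isNeg b)) v (a ∷ u))))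
                 (cong₂ (λ p x → if p then x else + 0) (∧-comm (isNeg a) (isNeg b)) (weigh⋆-comm _ u v)) ⟩
  weigh⋆ (step s (isNeg b)) v (a ∷ u) + weigh⋆ (step s (isNeg a)) (b ∷ v) u - mergeTerm s b a v u
    ≡⟨ weigh⋆-∷ s b v a u ⟨
  weigh⋆ s (b ∷ v) (a ∷ u) ∎
  where open ≡-Reasoning

AllWords : (Word → Set) → LC → Set
AllWords P = All (λ t → P (proj₂ t))

-- The words of u ⋆ v are the shuffles of u and v in which some adjacent negative letters,
-- one from each factor, are merged into the one from u.
module _ (Q : Word → Word → Word → Set)
  (nilˡ : ∀ v → Q [] v v)
  (nilʳ : ∀ a u → Q (a ∷ u) [] (a ∷ u))
  (keepˡ : ∀ {a u b v w} → Q u (b ∷ v) w → Q (a ∷ u) (b ∷ v) (a ∷ w))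
  (keepʳ : ∀ {a u b v w} → Q (a ∷ u) v w → Q (a ∷ u) (b ∷ v) (b ∷ w))
  (merge : ∀ {m n u v w} → Q u v w → Q (-[1+ m ] ∷ u) (-[1+ n ] ∷ v) (-[1+ m ] ∷ w))
  where

  star-All : ∀ u v → AllWords (Q u v) (star u v)
  star-All []      v       = nilˡ v ∷ []
  star-All (a ∷ u) []      = nilʳ a u ∷ []
  star-All (a ∷ u) (b ∷ v) =
    All.++⁺ (All.map⁺ (All.map keepˡ (star-All u (b ∷ v))))
      (All.++⁺ (All.map⁺ (All.map keepʳ (star-All (a ∷ u) v)))
        (All.map⁺ (mergedWords a b)))
    where
    mergedWords : ∀ a b → AllWords (Q (a ∷ u) (b ∷ v)) (bulletPre a b (star u v))
    mergedWords (+ _)    _        = []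
    mergedWords -[1+ _ ] (+ _)    = []
    mergedWords -[1+ _ ] -[1+ _ ] = All.map⁺ (All.map merge (star-All u v))

star-signs-⊆ : ∀ u v → AllWords (λ w → signs u ⊆ signs w × signs v ⊆ signs w) (star u v)
star-signs-⊆ = star-All (λ u v w → signs u ⊆ signs w × signs v ⊆ signs w)
  (λ v → minimum _ , ⊆-refl)
  (λ a u → ⊆-refl , minimum _)
  (λ (p , q) → refl ∷ p , _ ∷ʳ q)
  (λ (p , q) → _ ∷ʳ p , refl ∷ q)
  (λ (p , q) → refl ∷ p , refl ∷ q)

-- Unlike posPart it keeps + 0, which st turns into a positive letter.
nonNeg : Word → Word
nonNeg []             = []
nonNeg (+ n ∷ w)      = + n ∷ nonNeg w
nonNeg (-[1+ _ ] ∷ w) = nonNeg w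

star-nonNeg : ∀ u v → AllWords (λ w → Interleaving (nonNeg u) (nonNeg v) (nonNeg w)) (star u v)
star-nonNeg = star-All (λ u v w → Interleaving (nonNeg u) (nonNeg v) (nonNeg w))
  (λ v → right (Pointwise.refl refl))
  (λ a u → left (Pointwise.refl refl))
  (λ {a} {u} {b} {v} {w} → keepˡ {a} {u} {b} {v} {w})
  (λ {a} {u} {b} {v} {w} → keepʳ {a} {u} {b} {v} {w})
  (λ p → p)
  where
  keepˡ : ∀ {a u b v w} → Interleaving (nonNeg u) (nonNeg (b ∷ v)) (nonNeg w) →
          Interleaving (nonNeg (a ∷ u)) (nonNeg (b ∷ v)) (nonNeg (a ∷ w))
  keepˡ {+ _}    p = consˡ p
  keepˡ { -[1+ _ ]} p = p
  keepʳ : ∀ {a u b v w} → Interleaving (nonNeg (a ∷ u)) (nonNeg v) (nonNeg w) →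
          Interleaving (nonNeg (a ∷ u)) (nonNeg (b ∷ v)) (nonNeg (b ∷ w))
  keepʳ {b = + _}    p = consʳ p
  keepʳ {b = -[1+ _ ]} p = p

star-abs : ∀ u v → AllWords (λ w → ∃ λ z → map ∣_∣ w ⊆ z × z ↭ map ∣_∣ u ++ map ∣_∣ v) (star u v)
star-abs = star-All (λ u v w → ∃ λ z → map ∣_∣ w ⊆ z × z ↭ map ∣_∣ u ++ map ∣_∣ v)
  (λ v → _ , ⊆-refl , ↭-refl)
  (λ a u → _ , ⊆-refl , ↭-reflexive (sym (++-identityʳ _)))
  (λ (z , p , q) → _ , refl ∷ p , ↭-prep _ q)
  (λ {a} {u} {b} {v} (z , p , q) → _ , refl ∷ p , insert (map ∣_∣ (a ∷ u)) q)
  (λ {m} {n} {u} {v} (z , p , q) → _ , refl ∷ (_ ∷ʳ p) , ↭-prep _ (insert (map ∣_∣ u) q))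
  where
  insert : ∀ xs {x ys zs} → zs ↭ xs ++ ys → x ∷ zs ↭ xs ++ x ∷ ys
  insert xs {x} {ys} q = ↭-trans (↭-prep x q) (↭-sym (shift x xs ys))

Unique-resp-↭ : ∀ {xs ys : List ℕ} → xs ↭ ys → Unique xs → Unique ys
Unique-resp-↭ ↭.refl         u                     = u
Unique-resp-↭ (↭.prep x p)   (x∉ ∷ u)              = All-resp-↭ p x∉ ∷ Unique-resp-↭ p u
Unique-resp-↭ (↭.swap x y p) ((x≢y ∷ x∉) ∷ y∉ ∷ u) =
  ((λ y≡x → x≢y (sym y≡x)) ∷ All-resp-↭ p y∉) ∷ All-resp-↭ p x∉ ∷ Unique-resp-↭ p u
Unique-resp-↭ (↭.trans p q)  u                     = Unique-resp-↭ q (Unique-resp-↭ p u)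

Unique-⊆ : ∀ {xs ys : List ℕ} → xs ⊆ ys → Unique ys → Unique xs
Unique-⊆ []             []       = []
Unique-⊆ (_ ∷ʳ p)       (_ ∷ u)  = Unique-⊆ p u
Unique-⊆ (refl ∷ p)     (x∉ ∷ u) = All.tabulate (λ y∈ → All.lookup x∉ (lookup p y∈)) ∷ Unique-⊆ p u

star-unique : ∀ u v → Unique (map ∣_∣ u ++ map ∣_∣ v) → AllWords (λ w → Unique (map ∣_∣ w)) (star u v)
star-unique u v uv = All.map (λ (z , w⊆z , z↭uv) → Unique-⊆ w⊆z (Unique-resp-↭ (↭-sym z↭uv) uv)) (star-abs u v)

weigh-dead : ∀ s L → AllWords (λ w → run s w ≡ dead) L → weigh s L ≡ + 0
weigh-dead s []            []       = refl
weigh-dead s ((c , w) ∷ L) (d ∷ ds) = begin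
  c * weight (run s w) + weigh s L ≡⟨ cong₂ (λ t x → c * weight t + x) d (weigh-dead s L ds) ⟩
  c * + 0 + + 0                    ≡⟨ cong (_+ + 0) (ℤ.*-zeroʳ c) ⟩
  + 0                              ∎
  where open ≡-Reasoning

weigh⋆-[]ʳ : ∀ s u → weigh⋆ s u [] ≡ weight (run s u)
weigh⋆-[]ʳ s u = trans (cong (weigh s) (star-[]ʳ u)) (weigh⋆-[]ˡ s u)

weigh⋆-trailing-[] : ∀ b v → weigh⋆ trailing [] (b ∷ v) ≡ + 0
weigh⋆-trailing-[] b v = trans (weigh⋆-[]ˡ trailing (b ∷ v)) (cong weight (steps-dead (signs v)))

weigh⋆-deadˡ : ∀ s u v → run s u ≡ dead → weigh⋆ s u v ≡ + 0
weigh⋆-deadˡ s u v d = weigh-dead s (star u v) (All.map (λ (u⊆w , _) → steps-dead-⊆ s u⊆w d) (star-signs-⊆ u v))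

weigh⋆-middle-neg : ∀ m v → weigh⋆ middle [ -[1+ m ] ] v ≡ - weight (run middle v)
weigh⋆-middle-neg m []              = refl
weigh⋆-middle-neg m (+ n ∷ v)       = begin
  weigh⋆ middle [ -[1+ m ] ] (+ n ∷ v)
    ≡⟨ weigh⋆-∷ middle -[1+ m ] [] (+ n) v ⟩
  weigh⋆ trailing [] (+ n ∷ v) + weigh⋆ middle [ -[1+ m ] ] v - + 0
    ≡⟨ cong₂ (λ x y → x + y - + 0) (weigh⋆-trailing-[] (+ n) v) (weigh⋆-middle-neg m v) ⟩
  + 0 + - weight (run middle v) - + 0
    ≡⟨ trans (ℤ.+-identityʳ _) (ℤ.+-identityˡ _) ⟩
  - weight (run middle v) ∎
  where open ≡-Reasoning
weigh⋆-middle-neg m (-[1+ n ] ∷ v) = begin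
  weigh⋆ middle [ -[1+ m ] ] (-[1+ n ] ∷ v)
    ≡⟨ weigh⋆-∷ middle -[1+ m ] [] -[1+ n ] v ⟩
  weigh⋆ trailing [] (-[1+ n ] ∷ v) + weigh⋆ trailing [ -[1+ m ] ] v - weigh⋆ trailing [] v
    ≡⟨ cong₂ (λ x y → x + y - weigh⋆ trailing [] v)
         (weigh⋆-trailing-[] -[1+ n ] v) (weigh⋆-deadˡ trailing [ -[1+ m ] ] v refl) ⟩
  + 0 - weigh⋆ trailing [] v
    ≡⟨ trans (ℤ.+-identityˡ _) (cong -_ (weigh⋆-[]ˡ trailing v)) ⟩
  - weight (run middle (-[1+ n ] ∷ v)) ∎
  where open ≡-Reasoning

run-leading-allNeg : ∀ {u} → All Neg u → run leading u ≡ leading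
run-leading-allNeg {[]}            []               = refl
run-leading-allNeg {+ _ ∷ _}       (ℤ.+<+ () ∷ _)
run-leading-allNeg { -[1+ _ ] ∷ _} (_ ∷ negs)       = run-leading-allNeg negs

weigh⋆-leading-neg : ∀ m v → weigh⋆ leading [ -[1+ m ] ] v ≡ + 0
weigh⋆-leading-neg m []              = refl
weigh⋆-leading-neg m (+ n ∷ v)       = begin
  weigh⋆ leading [ -[1+ m ] ] (+ n ∷ v)
    ≡⟨ weigh⋆-∷ leading -[1+ m ] [] (+ n) v ⟩
  weigh⋆ leading [] (+ n ∷ v) + weigh⋆ middle [ -[1+ m ] ] v - + 0
    ≡⟨ cong₂ (λ x y → x + y - + 0) (weigh⋆-[]ˡ leading (+ n ∷ v)) (weigh⋆-middle-neg m v) ⟩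
  weight (run middle v) + - weight (run middle v) - + 0
    ≡⟨ trans (ℤ.+-identityʳ _) (ℤ.+-inverseʳ (weight (run middle v))) ⟩
  + 0 ∎
  where open ≡-Reasoning
weigh⋆-leading-neg m (-[1+ n ] ∷ v) = begin
  weigh⋆ leading [ -[1+ m ] ] (-[1+ n ] ∷ v)
    ≡⟨ weigh⋆-∷ leading -[1+ m ] [] -[1+ n ] v ⟩
  weigh⋆ leading [] v + weigh⋆ leading [ -[1+ m ] ] v - weigh⋆ leading [] v
    ≡⟨ cong (λ x → weigh⋆ leading [] v + x - weigh⋆ leading [] v) (weigh⋆-leading-neg m v) ⟩
  weigh⋆ leading [] v + + 0 - weigh⋆ leading [] v
    ≡⟨ trans (cong (_- weigh⋆ leading [] v) (ℤ.+-identityʳ (weigh⋆ leading [] v))) (ℤ.+-inverseʳ (weigh⋆ leading [] v)) ⟩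
  + 0 ∎
  where open ≡-Reasoning

weigh⋆-allNeg : ∀ a u v → All Neg (a ∷ u) → weigh⋆ leading (a ∷ u) v ≡ + 0
weigh⋆-allNeg (+ _)    _       _              (ℤ.+<+ () ∷ _)
weigh⋆-allNeg -[1+ m ] []      v              _            = weigh⋆-leading-neg m v
weigh⋆-allNeg -[1+ m ] (a ∷ u) []             negs         =
  trans (weigh⋆-[]ʳ leading (-[1+ m ] ∷ a ∷ u)) (cong weight (run-leading-allNeg negs))
weigh⋆-allNeg -[1+ m ] (a ∷ u) (+ n ∷ v)      (_ ∷ negs)   = begin
  weigh⋆ leading (-[1+ m ] ∷ a ∷ u) (+ n ∷ v)
    ≡⟨ weigh⋆-∷ leading -[1+ m ] (a ∷ u) (+ n) v ⟩
  weigh⋆ leading (a ∷ u) (+ n ∷ v) + weigh⋆ middle (-[1+ m ] ∷ a ∷ u) v - + 0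
    ≡⟨ cong₂ (λ x y → x + y - + 0) (weigh⋆-allNeg a u (+ n ∷ v) negs)
         (weigh⋆-deadˡ middle (-[1+ m ] ∷ a ∷ u) v (steps-dead (signs u))) ⟩
  + 0 ∎
  where open ≡-Reasoning
weigh⋆-allNeg -[1+ m ] (a ∷ u) (-[1+ n ] ∷ v) (neg ∷ negs) = begin
  weigh⋆ leading (-[1+ m ] ∷ a ∷ u) (-[1+ n ] ∷ v)
    ≡⟨ weigh⋆-∷ leading -[1+ m ] (a ∷ u) -[1+ n ] v ⟩
  weigh⋆ leading (a ∷ u) (-[1+ n ] ∷ v) + weigh⋆ leading (-[1+ m ] ∷ a ∷ u) v - weigh⋆ leading (a ∷ u) v
    ≡⟨ cong₂ _-_ (cong₂ _+_ (weigh⋆-allNeg a u (-[1+ n ] ∷ v) negs) (weigh⋆-allNeg -[1+ m ] (a ∷ u) v (neg ∷ negs)))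
                 (weigh⋆-allNeg a u v negs) ⟩
  + 0 ∎
  where open ≡-Reasoning

countBelow : Word → ℕ → ℕ
countBelow w k = length (filter (λ x → ∣ x ∣ ℕ.<? k) w)

countBelow-mono : ∀ w {k k′} → k ≤ k′ → countBelow w k ≤ countBelow w k′
countBelow-mono w k≤k′ =
  length-mono-≤ (filter⁺ (λ x → ∣ x ∣ ℕ.<? _) (λ x → ∣ x ∣ ℕ.<? _) (λ { refl x<k → ℕ.<-≤-trans x<k k≤k′ }) (⊆-refl {x = w}))

countBelow-strict : ∀ w {y k′} → y ∈ w → ∣ y ∣ < k′ → countBelow w ∣ y ∣ < countBelow w k′
countBelow-strict (x ∷ w) {k′ = k′} (here refl) x<k′
  rewrite filter-reject (λ z → ∣ z ∣ ℕ.<? ∣ x ∣) {x} {w} (ℕ.<-irrefl refl)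
        | filter-accept (λ z → ∣ z ∣ ℕ.<? k′) {x} {w} x<k′
  = s≤s (countBelow-mono w (ℕ.<⇒≤ x<k′))
countBelow-strict (x ∷ w) {y} {k′} (there y∈) y<k′ with ∣ x ∣ ℕ.<? ∣ y ∣ | ∣ x ∣ ℕ.<? k′
... | yes x<y | yes x<k′
  rewrite filter-accept (λ z → ∣ z ∣ ℕ.<? ∣ y ∣) {x} {w} x<y | filter-accept (λ z → ∣ z ∣ ℕ.<? k′) {x} {w} x<k′
  = s≤s (countBelow-strict w y∈ y<k′)
... | yes x<y | no x≮k′  = ⊥-elim (x≮k′ (ℕ.<-trans x<y y<k′))
... | no x≮y  | yes x<k′
  rewrite filter-reject (λ z → ∣ z ∣ ℕ.<? ∣ y ∣) {x} {w} x≮y | filter-accept (λ z → ∣ z ∣ ℕ.<? k′) {x} {w} x<k′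
  = ℕ.m≤n⇒m≤1+n (countBelow-strict w y∈ y<k′)
... | no x≮y  | no x≮k′
  rewrite filter-reject (λ z → ∣ z ∣ ℕ.<? ∣ y ∣) {x} {w} x≮y | filter-reject (λ z → ∣ z ∣ ℕ.<? k′) {x} {w} x≮k′
  = countBelow-strict w y∈ y<k′

countBelow-<⇔ : ∀ w {x y} → x ∈ w → countBelow w ∣ x ∣ < countBelow w ∣ y ∣ ⇔ ∣ x ∣ < ∣ y ∣
countBelow-<⇔ w {x} {y} x∈ = mk⇔ reflect (countBelow-strict w x∈)
  where
  reflect : countBelow w ∣ x ∣ < countBelow w ∣ y ∣ → ∣ x ∣ < ∣ y ∣
  reflect c< = ℕ.≰⇒> λ y≤x → ℕ.<⇒≱ c< (countBelow-mono w y≤x)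

countBelow-≡⇔ : ∀ w {x y} → x ∈ w → y ∈ w → countBelow w ∣ x ∣ ≡ countBelow w ∣ y ∣ ⇔ ∣ x ∣ ≡ ∣ y ∣
countBelow-≡⇔ w {x} {y} x∈ y∈ = mk⇔ reflect (cong (countBelow w))
  where
  reflect : countBelow w ∣ x ∣ ≡ countBelow w ∣ y ∣ → ∣ x ∣ ≡ ∣ y ∣
  reflect c≡ with ℕ.<-cmp ∣ x ∣ ∣ y ∣
  ... | tri< x<y _ _ = ⊥-elim (ℕ.<-irrefl c≡ (countBelow-strict w x∈ x<y))
  ... | tri≈ _ x≡y _ = x≡y
  ... | tri> _ _ y<x = ⊥-elim (ℕ.<-irrefl (sym c≡) (countBelow-strict w y∈ y<x))

rank : Word → ℤ → ℤ
rank w a = sign a ◃ suc (countBelow w ∣ a ∣)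

stAux-unique : ∀ seen rest full → Unique (map ∣_∣ seen ++ map ∣_∣ rest) →
               stAux seen rest full ≡ map (rank full) rest
stAux-unique seen []         full _ = refl
stAux-unique seen (a ∷ rest) full u = cong₂ _∷_ (cong (λ k → sign a ◃ suc k) no-ties) (stAux-unique (seen ++ [ a ]) rest full u′)
  where
  a∉seen : All (λ x → ¬ ∣ x ∣ ≡ ∣ a ∣) seen
  a∉seen = All.map (λ a≢x x≡a → a≢x (sym x≡a))
             (All.map⁻ (All.++⁻ˡ (map ∣_∣ seen) (AllPairs.head (Unique-resp-↭ (shift ∣ a ∣ (map ∣_∣ seen) (map ∣_∣ rest)) u))))
  no-ties : countBelow full ∣ a ∣ ℕ.+ length (filter (λ x → ∣ x ∣ ℕ.≟ ∣ a ∣) seen) ≡ countBelow full ∣ a ∣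
  no-ties = trans (cong (λ xs → countBelow full ∣ a ∣ ℕ.+ length xs) (filter-none (λ x → ∣ x ∣ ℕ.≟ ∣ a ∣) a∉seen)) (ℕ.+-identityʳ _)
  u′ : Unique (map ∣_∣ (seen ++ [ a ]) ++ map ∣_∣ rest)
  u′ = subst Unique (sym (trans (cong (_++ map ∣_∣ rest) (map-++ ∣_∣ seen [ a ])) (++-assoc (map ∣_∣ seen) [ ∣ a ∣ ] (map ∣_∣ rest)))) u

st-unique : ∀ w → Unique (map ∣_∣ w) → st w ≡ map (rank w) w
st-unique w = stAux-unique [] w w

posPart-map-rank : ∀ w u → posPart (map (rank w) u) ≡ map (rank w) (nonNeg u)
posPart-map-rank w []             = refl
posPart-map-rank w (+ n ∷ u)      = cong (_ ∷_) (posPart-map-rank w u)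
posPart-map-rank w (-[1+ n ] ∷ u) = posPart-map-rank w u

length-filter-map : ∀ {P Q : ℤ → Set} (P? : Decidable P) (Q? : Decidable Q) f xs →
  All (λ x → P (f x) ⇔ Q x) xs → length (filter P? (map f xs)) ≡ length (filter Q? xs)
length-filter-map P? Q? f []       []               = refl
length-filter-map P? Q? f (x ∷ xs) (Pfx⇔Qx ∷ equivs) with Q? x
... | yes Qx rewrite filter-accept P? {f x} {map f xs} (Equivalence.from Pfx⇔Qx Qx)
  = cong suc (length-filter-map P? Q? f xs equivs)
... | no ¬Qx rewrite filter-reject P? {f x} {map f xs} (λ Pfx → ¬Qx (Equivalence.to Pfx⇔Qx Pfx))
  = length-filter-map P? Q? f xs equivs

module _ (f : ℤ → ℤ) (u : Word)
  (sign-f : ∀ {x} → x ∈ u → sign (f x) ≡ sign x)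
  (<-f : ∀ {x y} → x ∈ u → y ∈ u → ∣ f x ∣ < ∣ f y ∣ ⇔ ∣ x ∣ < ∣ y ∣)
  (≡-f : ∀ {x y} → x ∈ u → y ∈ u → ∣ f x ∣ ≡ ∣ f y ∣ ⇔ ∣ x ∣ ≡ ∣ y ∣)
  where

  stAux-map : ∀ seen rest → All (_∈ u) seen → All (_∈ u) rest →
              stAux (map f seen) (map f rest) (map f u) ≡ stAux seen rest u
  stAux-map seen []         _       _            = refl
  stAux-map seen (a ∷ rest) seen⊆u (a∈ ∷ rest⊆u) = cong₂ _∷_
    (cong₂ (λ s k → s ◃ suc k) (sign-f a∈)
      (cong₂ ℕ._+_
        (length-filter-map _ _ f u (All.tabulate (λ x∈ → <-f x∈ a∈)))
        (length-filter-map _ _ f seen (All.map (λ x∈ → ≡-f x∈ a∈) seen⊆u))))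
    (trans (cong (λ s → stAux s (map f rest) (map f u)) (sym (map-++ f seen [ a ])))
           (stAux-map (seen ++ [ a ]) rest (All.++⁺ seen⊆u (a∈ ∷ [])) rest⊆u))

  st-map : st (map f u) ≡ st u
  st-map = stAux-map [] u [] (All.tabulate (λ x∈ → x∈))

nonNeg-⊆ : ∀ {x} w → x ∈ nonNeg w → x ∈ w
nonNeg-⊆ (+ n ∷ w)      (here x≡)  = here x≡
nonNeg-⊆ (+ n ∷ w)      (there x∈) = there (nonNeg-⊆ w x∈)
nonNeg-⊆ (-[1+ n ] ∷ w) x∈         = there (nonNeg-⊆ w x∈)

∣rank∣ : ∀ w x → ∣ rank w x ∣ ≡ suc (countBelow w ∣ x ∣)
∣rank∣ w x = ℤ.abs-◃ (sign x) _

st-posPart : ∀ w → Unique (map ∣_∣ w) → st (posPart (st w)) ≡ st (nonNeg w)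
st-posPart w unique = begin
  st (posPart (st w))              ≡⟨ cong (st ∘ posPart) (st-unique w unique) ⟩
  st (posPart (map (rank w) w))    ≡⟨ cong st (posPart-map-rank w w) ⟩
  st (map (rank w) (nonNeg w))     ≡⟨ st-map (rank w) (nonNeg w) (λ {x} _ → ℤ.sign-◃ (sign x) _) rank-< rank-≡ ⟩
  st (nonNeg w)                    ∎
  where
  open ≡-Reasoning
  rank-< : ∀ {x y} → x ∈ nonNeg w → y ∈ nonNeg w → ∣ rank w x ∣ < ∣ rank w y ∣ ⇔ ∣ x ∣ < ∣ y ∣
  rank-< {x} {y} x∈ _ rewrite ∣rank∣ w x | ∣rank∣ w y =
    mk⇔ (λ r< → Equivalence.to (countBelow-<⇔ w {y = y} (nonNeg-⊆ w x∈)) (ℕ.s<s⁻¹ r<))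
        (λ x<y → ℕ.s<s (Equivalence.from (countBelow-<⇔ w {y = y} (nonNeg-⊆ w x∈)) x<y))
  rank-≡ : ∀ {x y} → x ∈ nonNeg w → y ∈ nonNeg w → ∣ rank w x ∣ ≡ ∣ rank w y ∣ ⇔ ∣ x ∣ ≡ ∣ y ∣
  rank-≡ {x} {y} x∈ y∈ rewrite ∣rank∣ w x | ∣rank∣ w y =
    mk⇔ (λ r≡ → Equivalence.to (countBelow-≡⇔ w (nonNeg-⊆ w x∈) (nonNeg-⊆ w y∈)) (ℕ.suc-injective r≡))
        (cong (λ k → suc (countBelow w k)))

signs-stAux : ∀ seen rest full → signs (stAux seen rest full) ≡ signs rest
signs-stAux seen []               full = refl
signs-stAux seen (+ n ∷ rest)      full = cong (false ∷_) (signs-stAux (seen ++ [ + n ]) rest full)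
signs-stAux seen (-[1+ n ] ∷ rest) full = cong (true ∷_) (signs-stAux (seen ++ [ -[1+ n ] ]) rest full)

run-st : ∀ s w → run s (st w) ≡ run s w
run-st s w = cong (steps s) (signs-stAux [] w w)

stAux-nonzero : ∀ seen rest full → All (_≢ + 0) (stAux seen rest full)
stAux-nonzero seen []               full = []
stAux-nonzero seen (+ n ∷ rest)      full = (λ ()) ∷ stAux-nonzero (seen ++ [ + n ]) rest full
stAux-nonzero seen (-[1+ n ] ∷ rest) full = (λ ()) ∷ stAux-nonzero (seen ++ [ -[1+ n ] ]) rest full

indicator : Word → Word → ℤ
indicator x Y = coeff x [ (+ 1 , Y) ]

coeff-++ : ∀ x L M → coeff x (L ++ M) ≡ coeff x L + coeff x M
coeff-++ x []            M = sym (ℤ.+-identityˡ _)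
coeff-++ x ((c , v) ∷ L) M with ≡-dec ℤ._≟_ v x
... | yes _ = trans (cong (_+_ c) (coeff-++ x L M)) (sym (ℤ.+-assoc c (coeff x L) (coeff x M)))
... | no  _ = coeff-++ x L M

coeff-scale : ∀ x c L → coeff x (scale c L) ≡ c * coeff x L
coeff-scale x c []            = sym (ℤ.*-zeroʳ c)
coeff-scale x c ((d , v) ∷ L) with ≡-dec ℤ._≟_ v x
... | yes _ = trans (cong (_+_ (c * d)) (coeff-scale x c L)) (sym (ℤ.*-distribˡ-+ c d (coeff x L)))
... | no  _ = coeff-scale x c L

coeff-single : ∀ x c Y → coeff x [ (c , Y) ] ≡ c * indicator x Y
coeff-single x c Y with ≡-dec ℤ._≟_ Y x
... | yes _ = trans (ℤ.+-identityʳ c) (sym (ℤ.*-identityʳ c))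
... | no  _ = sym (ℤ.*-zeroʳ c)

Fits : ℕ → ℕ → Word → Set
Fits i j π = i ℕ.+ j < length π × Shape (length π) i j π

φ₂term-fits : ∀ i j π → Fits i j π → φ₂term i j π ≡ [ ((- + 1) ^ j , st (posPart π)) ]
φ₂term-fits i j π (l , s) with i ℕ.+ j ℕ.<? length π | shape? (length π) i j π
... | yes _ | yes _ = refl
... | no ¬l | _     = ⊥-elim (¬l l)
... | yes _ | no ¬s = ⊥-elim (¬s s)

φ₂term-unfit : ∀ i j π → ¬ Fits i j π → φ₂term i j π ≡ []
φ₂term-unfit i j π ¬f with i ℕ.+ j ℕ.<? length π | shape? (length π) i j π
... | yes l | yes s = ⊥-elim (¬f (l , s))
... | yes _ | no _  = refl
... | no _  | _     = refl

take-suc∸ : ∀ (a : ℤ) π {j} → j ≤ length π → take (suc (length π) ∸ j) (a ∷ π) ≡ a ∷ take (length π ∸ j) π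
take-suc∸ a π j≤ rewrite ℕ.+-∸-assoc 1 j≤ = refl

drop-suc∸ : ∀ (a : ℤ) π {j} → j ≤ length π → drop (suc (length π) ∸ j) (a ∷ π) ≡ drop (length π ∸ j) π
drop-suc∸ a π j≤ rewrite ℕ.+-∸-assoc 1 j≤ = refl

Fits-negHead : ∀ m π i j → Fits (suc i) j (-[1+ m ] ∷ π) ⇔ Fits i j π
Fits-negHead m π i j = mk⇔
  (λ { (s≤s l , (_ ∷ negs , poss , negs′)) → l , negs , poss , subst (All Neg) (drop-suc∸ _ π (j≤ l)) negs′ })
  (λ (l , negs , poss , negs′) → s≤s l , (ℤ.-<+ ∷ negs) , poss , subst (All Neg) (sym (drop-suc∸ _ π (j≤ l))) negs′)
  where
  j≤ : i ℕ.+ j < length π → j ≤ length π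
  j≤ l = ℕ.≤-trans (ℕ.m≤n+m j i) (ℕ.<⇒≤ l)

φ₂term-negHead : ∀ m π i j → φ₂term (suc i) j (-[1+ m ] ∷ π) ≡ φ₂term i j π
φ₂term-negHead m π i j with (i ℕ.+ j ℕ.<? length π) ×-dec shape? (length π) i j π
... | yes fits  = trans (φ₂term-fits _ _ _ (Equivalence.from (Fits-negHead m π i j) fits)) (sym (φ₂term-fits i j π fits))
... | no ¬fits = trans (φ₂term-unfit _ _ _ (λ f → ¬fits (Equivalence.to (Fits-negHead m π i j) f))) (sym (φ₂term-unfit i j π ¬fits))

φ₂term-0-negHead : ∀ m π j → φ₂term 0 j (-[1+ m ] ∷ π) ≡ []
φ₂term-0-negHead m π j = φ₂term-unfit 0 j (-[1+ m ] ∷ π) λ { (s≤s l , _ , poss , _) →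
  case (subst (All Pos) (take-suc∸ -[1+ m ] π l) poss) }
  where
  case : ∀ {u} → ¬ All Pos (-[1+ m ] ∷ u)
  case (() ∷ _)

φ₂term-suc-posHead : ∀ n π i j → φ₂term (suc i) j (+ n ∷ π) ≡ []
φ₂term-suc-posHead n π i j = φ₂term-unfit (suc i) j (+ n ∷ π) λ { (_ , (ℤ.+<+ () ∷ _) , _) }

φ₂at : Word → ℕ → LC
φ₂at π i = φ₂term i 0 π ++ φ₂term i 1 π

φ₂shapes : Word → LC
φ₂shapes π = concatMap (φ₂at π) (upTo (length π))

concatMap-suc : ∀ (F : ℕ → LC) n → concatMap F (applyUpTo suc n) ≡ concatMap (λ i → F (suc i)) (upTo n)
concatMap-suc F n = trans (cong (concatMap F) (sym (map-upTo suc n))) (concatMap-map F suc (upTo n))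

φ₂shapes-negHead : ∀ m π → φ₂shapes (-[1+ m ] ∷ π) ≡ φ₂shapes π
φ₂shapes-negHead m π = begin
  φ₂at (-[1+ m ] ∷ π) 0 ++ concatMap (φ₂at (-[1+ m ] ∷ π)) (applyUpTo suc (length π))
    ≡⟨ cong₂ _++_ (cong₂ _++_ (φ₂term-0-negHead m π 0) (φ₂term-0-negHead m π 1)) (concatMap-suc _ (length π)) ⟩
  concatMap (λ i → φ₂at (-[1+ m ] ∷ π) (suc i)) (upTo (length π))
    ≡⟨ concatMap-cong (λ i → cong₂ _++_ (φ₂term-negHead m π i 0) (φ₂term-negHead m π i 1)) (upTo (length π)) ⟩
  φ₂shapes π ∎
  where open ≡-Reasoning

φ₂shapes-posHead : ∀ n π → φ₂shapes (+ n ∷ π) ≡ φ₂at (+ n ∷ π) 0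
φ₂shapes-posHead n π = begin
  φ₂at (+ n ∷ π) 0 ++ concatMap (φ₂at (+ n ∷ π)) (applyUpTo suc (length π))
    ≡⟨ cong (φ₂at (+ n ∷ π) 0 ++_) (trans (concatMap-suc _ (length π)) (vanish (upTo (length π)))) ⟩
  φ₂at (+ n ∷ π) 0 ++ []
    ≡⟨ ++-identityʳ _ ⟩
  φ₂at (+ n ∷ π) 0 ∎
  where
  open ≡-Reasoning
  vanish : ∀ is → concatMap (λ i → φ₂at (+ n ∷ π) (suc i)) is ≡ []
  vanish []       = refl
  vanish (i ∷ is) rewrite φ₂term-suc-posHead n π i 0 | φ₂term-suc-posHead n π i 1 = vanish is

steps-trailing≢middle : ∀ bs → steps trailing bs ≢ middle
steps-trailing≢middle []       ()
steps-trailing≢middle (_ ∷ bs) r with () ← trans (sym (steps-dead bs)) r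

run-middle-allPos : ∀ {w} → All Pos w → run middle w ≡ middle
run-middle-allPos {[]}            []          = refl
run-middle-allPos {+ _ ∷ _}       (_ ∷ poss)  = run-middle-allPos poss
run-middle-allPos { -[1+ _ ] ∷ _} (() ∷ _)

run-middle≡middle⇒allPos : ∀ w → All (_≢ + 0) w → run middle w ≡ middle → All Pos w
run-middle≡middle⇒allPos []             _         _ = []
run-middle≡middle⇒allPos (+ zero ∷ w)   (nz ∷ _)  _ = ⊥-elim (nz refl)
run-middle≡middle⇒allPos (+ suc _ ∷ w)  (_ ∷ nzs) r = ℤ.+<+ (s≤s z≤n) ∷ run-middle≡middle⇒allPos w nzs r
run-middle≡middle⇒allPos (-[1+ _ ] ∷ w) _         r = ⊥-elim (steps-trailing≢middle (signs w) r)

run-middle≡trailing⇔ : ∀ b w → All (_≢ + 0) (b ∷ w) →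
  run middle (b ∷ w) ≡ trailing ⇔ (All Pos (take (length w) (b ∷ w)) × All Neg (drop (length w) (b ∷ w)))
run-middle≡trailing⇔ (+ zero)  w       (nz ∷ _)  = ⊥-elim (nz refl)
run-middle≡trailing⇔ -[1+ _ ]  []      _         = mk⇔ (λ _ → [] , ℤ.-<+ ∷ []) (λ _ → refl)
run-middle≡trailing⇔ -[1+ _ ]  (c ∷ w) _         = mk⇔ (λ r → ⊥-elim (dead≢trailing (trans (sym (steps-dead (signs w))) r))) (λ { ((() ∷ _) , _) })
  where
  dead≢trailing : dead ≢ trailing
  dead≢trailing ()
run-middle≡trailing⇔ (+ suc _) []      _         = mk⇔ (λ ()) (λ { (_ , (ℤ.+<+ () ∷ _)) })
run-middle≡trailing⇔ (+ suc _) (c ∷ w) (_ ∷ nzs) = mk⇔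
  (λ r → let (poss , negs) = Equivalence.to (run-middle≡trailing⇔ c w nzs) r in ℤ.+<+ (s≤s z≤n) ∷ poss , negs)
  (λ { ((_ ∷ poss) , negs) → Equivalence.from (run-middle≡trailing⇔ c w nzs) (poss , negs) })

Fits-00-posHead : ∀ n π → All (_≢ + 0) π → Fits 0 0 (+ suc n ∷ π) ⇔ run middle π ≡ middle
Fits-00-posHead n π nzs = mk⇔
  (λ { (_ , _ , (_ ∷ poss) , _) → run-middle-allPos (subst (All Pos) (take-all _ π ℕ.≤-refl) poss) })
  (λ r → s≤s z≤n , [] ,
         ℤ.+<+ (s≤s z≤n) ∷ subst (All Pos) (sym (take-all _ π ℕ.≤-refl)) (run-middle≡middle⇒allPos π nzs r) ,
         subst (All Neg) (sym (drop-all _ π ℕ.≤-refl)) [])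

Fits-01-posHead : ∀ n π → All (_≢ + 0) π → Fits 0 1 (+ suc n ∷ π) ⇔ run middle π ≡ trailing
Fits-01-posHead n []      _   = mk⇔ (λ { (s≤s () , _) }) (λ ())
Fits-01-posHead n (b ∷ π) nzs = mk⇔
  (λ { (_ , _ , (_ ∷ poss) , negs) → Equivalence.from (run-middle≡trailing⇔ b π nzs) (poss , negs) })
  (λ r → let (poss , negs) = Equivalence.to (run-middle≡trailing⇔ b π nzs) r
         in s≤s (s≤s z≤n) , [] , ℤ.+<+ (s≤s z≤n) ∷ poss , negs)

coeff-φ₂at : ∀ x π s → (Fits 0 0 π ⇔ s ≡ middle) → (Fits 0 1 π ⇔ s ≡ trailing) →
  coeff x (φ₂at π 0) ≡ weight s * indicator x (st (posPart π))
coeff-φ₂at x π middle fits₀₀ fits₀₁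
  rewrite φ₂term-fits 0 0 π (Equivalence.from fits₀₀ refl)
        | φ₂term-unfit 0 1 π (λ f → case Equivalence.to fits₀₁ f of λ ())
  = sym (ℤ.*-identityˡ (indicator x (st (posPart π))))
coeff-φ₂at x π trailing fits₀₀ fits₀₁
  rewrite φ₂term-unfit 0 0 π (λ f → case Equivalence.to fits₀₀ f of λ ())
        | φ₂term-fits 0 1 π (Equivalence.from fits₀₁ refl)
  = coeff-single x (- + 1) (st (posPart π))
coeff-φ₂at x π leading fits₀₀ fits₀₁
  rewrite φ₂term-unfit 0 0 π (λ f → case Equivalence.to fits₀₀ f of λ ())
        | φ₂term-unfit 0 1 π (λ f → case Equivalence.to fits₀₁ f of λ ())
  = refl
coeff-φ₂at x π dead fits₀₀ fits₀₁
  rewrite φ₂term-unfit 0 0 π (λ f → case Equivalence.to fits₀₀ f of λ ())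
        | φ₂term-unfit 0 1 π (λ f → case Equivalence.to fits₀₁ f of λ ())
  = refl

coeff-φ₂shapes : ∀ x π → All (_≢ + 0) π → coeff x (φ₂shapes π) ≡ weight (run leading π) * indicator x (st (posPart π))
coeff-φ₂shapes x []             []         = refl
coeff-φ₂shapes x (+ zero ∷ π)   (nz ∷ _)   = ⊥-elim (nz refl)
coeff-φ₂shapes x (+ suc n ∷ π)  (_ ∷ nzs)  =
  trans (cong (coeff x) (φ₂shapes-posHead (suc n) π))
        (coeff-φ₂at x (+ suc n ∷ π) (run middle π) (Fits-00-posHead n π nzs) (Fits-01-posHead n π nzs))
coeff-φ₂shapes x (-[1+ m ] ∷ π) (_ ∷ nzs)  = trans (cong (coeff x) (φ₂shapes-negHead m π)) (coeff-φ₂shapes x π nzs)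

coeff-φ₂-st : ∀ x w → w ≢ [] → coeff x (φ₂ (st w)) ≡ weight (run leading w) * indicator x (st (posPart (st w)))
coeff-φ₂-st x []      ne = ⊥-elim (ne refl)
coeff-φ₂-st x (a ∷ w) _  = begin
  coeff x (φ₂shapes (st (a ∷ w)) ++ [])
    ≡⟨ cong (coeff x) (++-identityʳ (φ₂shapes (st (a ∷ w)))) ⟩
  coeff x (φ₂shapes (st (a ∷ w)))
    ≡⟨ coeff-φ₂shapes x (st (a ∷ w)) (stAux-nonzero [] (a ∷ w) (a ∷ w)) ⟩
  weight (run leading (st (a ∷ w))) * indicator x (st (posPart (st (a ∷ w))))
    ≡⟨ cong (λ s → weight s * indicator x (st (posPart (st (a ∷ w))))) (run-st leading (a ∷ w)) ⟩
  weight (run leading (a ∷ w)) * indicator x (st (posPart (st (a ∷ w)))) ∎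
  where open ≡-Reasoning

coeff-φ₂LC-stLC : ∀ x k L → AllWords (λ w → coeff x (φ₂ (st w)) ≡ weight (run leading w) * k) L →
                  coeff x (φ₂LC (stLC L)) ≡ weigh leading L * k
coeff-φ₂LC-stLC x k []            []         = refl
coeff-φ₂LC-stLC x k ((c , w) ∷ L) (eq ∷ eqs) = begin
  coeff x (scale c (φ₂ (st w)) ++ φ₂LC (stLC L))
    ≡⟨ coeff-++ x (scale c (φ₂ (st w))) _ ⟩
  coeff x (scale c (φ₂ (st w))) + coeff x (φ₂LC (stLC L))
    ≡⟨ cong₂ _+_ (trans (coeff-scale x c (φ₂ (st w))) (cong (c *_) eq)) (coeff-φ₂LC-stLC x k L eqs) ⟩
  c * (weight (run leading w) * k) + weigh leading L * k
    ≡⟨ cong (_+ weigh leading L * k) (ℤ.*-assoc c (weight (run leading w)) k) ⟨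
  c * weight (run leading w) * k + weigh leading L * k
    ≡⟨ ℤ.*-distribʳ-+ k (c * weight (run leading w)) (weigh leading L) ⟨
  weigh leading ((c , w) ∷ L) * k ∎
  where open ≡-Reasoning

φ₂LC-stLC-dead : ∀ L → AllWords (λ w → run leading w ≡ dead) L → IsZero (φ₂LC (stLC L))
φ₂LC-stLC-dead L dies x = begin
  coeff x (φ₂LC (stLC L)) ≡⟨ coeff-φ₂LC-stLC x (+ 0) L (All.map (λ {t} → vanishes (proj₂ t)) dies) ⟩
  weigh leading L * + 0   ≡⟨ ℤ.*-zeroʳ (weigh leading L) ⟩
  + 0                     ∎
  where
  open ≡-Reasoning
  vanishes : ∀ w → run leading w ≡ dead → coeff x (φ₂ (st w)) ≡ weight (run leading w) * + 0
  vanishes []      ()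
  vanishes (a ∷ w) d rewrite d =
    trans (coeff-φ₂-st x (a ∷ w) (λ ())) (cong (λ s → weight s * indicator x (st (posPart (st (a ∷ w))))) d)

interleave-[]ˡ-≡ : ∀ {ys zs : Word} → Interleaving [] ys zs → zs ≡ ys
interleave-[]ˡ-≡ []         = refl
interleave-[]ˡ-≡ (consʳ sp) = cong (_ ∷_) (interleave-[]ˡ-≡ sp)

interleave-[]ʳ-≡ : ∀ {xs zs : Word} → Interleaving xs [] zs → zs ≡ xs
interleave-[]ʳ-≡ []         = refl
interleave-[]ʳ-≡ (consˡ sp) = cong (_ ∷_) (interleave-[]ʳ-≡ sp)

nonNeg-allNeg : ∀ {u} → All Neg u → nonNeg u ≡ []
nonNeg-allNeg {[]}            []             = refl
nonNeg-allNeg {+ _ ∷ _}       (ℤ.+<+ () ∷ _)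
nonNeg-allNeg { -[1+ _ ] ∷ _} (_ ∷ negs)     = nonNeg-allNeg negs

nonEmpty-⊆ : ∀ {b bs} w → b ∷ bs ⊆ signs w → w ≢ []
nonEmpty-⊆ []      ()
nonEmpty-⊆ (_ ∷ _) _ ()

coeff-φ₂LC-star : ∀ x u v P → Unique (map ∣_∣ u ++ map ∣_∣ v) →
  AllWords (λ w → w ≢ [] × nonNeg w ≡ P) (star u v) →
  coeff x (φ₂LC (stLC (star u v))) ≡ weigh⋆ leading u v * indicator x (st P)
coeff-φ₂LC-star x u v P uv words =
  coeff-φ₂LC-stLC x (indicator x (st P)) (star u v) (All.zipWith (λ {t} → evaluate (proj₂ t)) (star-unique u v uv , words))
  where
  evaluate : ∀ w → Unique (map ∣_∣ w) × (w ≢ [] × nonNeg w ≡ P) →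
             coeff x (φ₂ (st w)) ≡ weight (run leading w) * indicator x (st P)
  evaluate w (unique , ne , w⁺≡P) =
    trans (coeff-φ₂-st x w ne) (cong (λ Y → weight (run leading w) * indicator x Y) (trans (st-posPart w unique) (cong st w⁺≡P)))

data Annihilating : Word → Set where
  dies   : ∀ {u} → run leading u ≡ dead → Annihilating u
  allNeg : ∀ {a u} → All Neg (a ∷ u) → Annihilating (a ∷ u)

star-annihilatingˡ : ∀ {u} v → Annihilating u → Unique (map ∣_∣ u ++ map ∣_∣ v) → IsZero (φ₂LC (stLC (star u v)))
star-annihilatingˡ {u} v (dies d) _ =
  φ₂LC-stLC-dead (star u v) (All.map (λ (u⊆w , _) → steps-dead-⊆ leading u⊆w d) (star-signs-⊆ u v))
star-annihilatingˡ {a ∷ u} v (allNeg negs) uv x = begin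
  coeff x (φ₂LC (stLC (star (a ∷ u) v)))              ≡⟨ coeff-φ₂LC-star x (a ∷ u) v (nonNeg v) uv words ⟩
  weigh⋆ leading (a ∷ u) v * indicator x (st (nonNeg v)) ≡⟨ cong (_* indicator x (st (nonNeg v))) (weigh⋆-allNeg a u v negs) ⟩
  + 0                                                   ∎
  where
  open ≡-Reasoning
  words : AllWords (λ w → w ≢ [] × nonNeg w ≡ nonNeg v) (star (a ∷ u) v)
  words = All.zipWith (λ { {t} ((u⊆w , _) , sp) →
      nonEmpty-⊆ (proj₂ t) u⊆w , interleave-[]ˡ-≡ (subst (λ z → Interleaving z _ _) (nonNeg-allNeg negs) sp) })
    (star-signs-⊆ (a ∷ u) v , star-nonNeg (a ∷ u) v)

star-annihilatingʳ : ∀ u {v} → Annihilating v → Unique (map ∣_∣ u ++ map ∣_∣ v) → IsZero (φ₂LC (stLC (star u v)))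
star-annihilatingʳ u {v} (dies d) _ =
  φ₂LC-stLC-dead (star u v) (All.map (λ (_ , v⊆w) → steps-dead-⊆ leading v⊆w d) (star-signs-⊆ u v))
star-annihilatingʳ u {b ∷ v} (allNeg negs) uv x = begin
  coeff x (φ₂LC (stLC (star u (b ∷ v))))              ≡⟨ coeff-φ₂LC-star x u (b ∷ v) (nonNeg u) uv words ⟩
  weigh⋆ leading u (b ∷ v) * indicator x (st (nonNeg u)) ≡⟨ cong (_* indicator x (st (nonNeg u))) vanishes ⟩
  + 0                                                   ∎
  where
  open ≡-Reasoning
  vanishes : weigh⋆ leading u (b ∷ v) ≡ + 0
  vanishes = trans (weigh⋆-comm leading u (b ∷ v)) (weigh⋆-allNeg b v u negs)
  words : AllWords (λ w → w ≢ [] × nonNeg w ≡ nonNeg u) (star u (b ∷ v))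
  words = All.zipWith (λ { {t} ((_ , v⊆w) , sp) →
      nonEmpty-⊆ (proj₂ t) v⊆w , interleave-[]ʳ-≡ (subst (λ z → Interleaving _ z _) (nonNeg-allNeg negs) sp) })
    (star-signs-⊆ u (b ∷ v) , star-nonNeg u (b ∷ v))

run-++ : ∀ s xs ys → run s (xs ++ ys) ≡ run (run s xs) ys
run-++ s []       ys = refl
run-++ s (x ∷ xs) ys = run-++ (step s (isNeg x)) xs ys

run-middle-negs : ∀ {E} → All Neg E → 1 < length E → run middle E ≡ dead
run-middle-negs {+ _ ∷ _}                  (ℤ.+<+ () ∷ _)
run-middle-negs { -[1+ _ ] ∷ + _ ∷ _}       (_ ∷ ℤ.+<+ () ∷ _)
run-middle-negs { -[1+ _ ] ∷ -[1+ _ ] ∷ E} _ _ = steps-dead (signs E)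
run-middle-negs { -[1+ _ ] ∷ []}           _ (s≤s ())

annihilating-++ : ∀ T M E → All Neg T → All Pos M → All Neg E → 1 < length E → Annihilating (T ++ M ++ E)
annihilating-++ []      []               (_ ∷ _) _     []          negsE _   = allNeg negsE
annihilating-++ (_ ∷ T) []               E       negsT []          negsE _   = allNeg (All.++⁺ negsT negsE)
annihilating-++ T       (-[1+ _ ] ∷ M)   E       _     (() ∷ _)    _     _
annihilating-++ T       (+ n ∷ M)        E       negsT (_ ∷ possM) negsE 1<E = dies (begin
  run leading (T ++ + n ∷ M ++ E)      ≡⟨ run-++ leading T (+ n ∷ M ++ E) ⟩
  run (run leading T) (+ n ∷ M ++ E)  ≡⟨ cong (λ s → run s (+ n ∷ M ++ E)) (run-leading-allNeg negsT) ⟩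
  run middle (M ++ E)                 ≡⟨ run-++ middle M E ⟩
  run (run middle M) E                ≡⟨ cong (λ s → run s E) (run-middle-allPos possM) ⟩
  run middle E                        ≡⟨ run-middle-negs negsE 1<E ⟩
  dead                                ∎)
  where open ≡-Reasoning

shape⇒annihilating : ∀ m i j σ → length σ ≡ m → i ℕ.+ j ≤ m → 1 < j → Shape m i j σ → Annihilating σ
shape⇒annihilating m i j σ |σ|≡m i+j≤m 1<j (negsT , possM , negsE) =
  subst Annihilating σ-split (annihilating-++ T M E negsT possM (subst (All Neg) (sym E≡) negsE) 1<|E|)
  where
  k = m ∸ (i ℕ.+ j)
  T = take i σ
  M = take k (drop i σ)
  E = drop k (drop i σ)
  σ-split : T ++ M ++ E ≡ σ
  σ-split = trans (cong (T ++_) (take++drop≡id k (drop i σ))) (take++drop≡id i σ)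
  E≡ : E ≡ drop (m ∸ j) σ
  E≡ = trans (drop-drop i k σ) (cong (λ n → drop n σ) (trans (sym (ℕ.+-∸-assoc i i+j≤m)) (ℕ.[m+n]∸[m+o]≡n∸o i m j)))
  1<|E| : 1 < length E
  1<|E| = subst (1 <_) (sym (begin
    length E                ≡⟨ cong length E≡ ⟩
    length (drop (m ∸ j) σ) ≡⟨ length-drop (m ∸ j) σ ⟩
    length σ ∸ (m ∸ j)      ≡⟨ cong (_∸ (m ∸ j)) |σ|≡m ⟩
    m ∸ (m ∸ j)             ≡⟨ ℕ.m∸[m∸n]≡n (ℕ.≤-trans (ℕ.m≤n+m j i) i+j≤m) ⟩
    j                       ∎)) 1<j
    where open ≡-Reasoning

signs-shiftW : ∀ m τ → signs (shiftW m τ) ≡ signs τ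
signs-shiftW m []             = refl
signs-shiftW m (+ n ∷ τ)      = cong₂ _∷_ (isNeg-+◃ (n ℕ.+ m)) (signs-shiftW m τ)
  where
  isNeg-+◃ : ∀ k → isNeg (Sign.+ ◃ k) ≡ false
  isNeg-+◃ zero    = refl
  isNeg-+◃ (suc k) = refl
signs-shiftW m (-[1+ n ] ∷ τ) = cong (true ∷_) (signs-shiftW m τ)

allNeg-shiftW : ∀ m {τ} → All Neg τ → All Neg (shiftW m τ)
allNeg-shiftW m {[]}            []             = []
allNeg-shiftW m {+ _ ∷ _}       (ℤ.+<+ () ∷ _)
allNeg-shiftW m { -[1+ _ ] ∷ _} (_ ∷ negs)     = ℤ.-<+ ∷ allNeg-shiftW m negs

annihilating-shiftW : ∀ m {τ} → Annihilating τ → Annihilating (shiftW m τ)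
annihilating-shiftW m {τ} (dies d)      = dies (trans (cong (steps leading) (signs-shiftW m τ)) d)
annihilating-shiftW m     (allNeg negs) = allNeg (allNeg-shiftW m negs)

abs-shiftW : ∀ m τ → map ∣_∣ (shiftW m τ) ≡ map (ℕ._+ m) (map ∣_∣ τ)
abs-shiftW m []      = refl
abs-shiftW m (x ∷ τ) = cong₂ _∷_ (ℤ.abs-◃ (sign x) (∣ x ∣ ℕ.+ m)) (abs-shiftW m τ)

signedPerm-unique : ∀ {n τ} → IsSignedPerm n τ → Unique (map ∣_∣ τ)
signedPerm-unique {n} (_ , perm) = Unique-resp-↭ (↭-sym perm) (Unique.map⁺ ℕ.suc-injective (Unique.upTo⁺ n))

signedPerm-bounds : ∀ {n τ} → IsSignedPerm n τ → All (λ k → 0 < k × k ≤ n) (map ∣_∣ τ)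
signedPerm-bounds {n} (_ , perm) = All-resp-↭ (↭-sym perm) (All.map⁺ (All.map (λ i<n → ℕ.z<s , i<n) (All.all-upTo n)))

signedPerms-unique : ∀ {m n σ τ} → IsSignedPerm m σ → IsSignedPerm n τ → Unique (map ∣_∣ σ ++ map ∣_∣ (shiftW m τ))
signedPerms-unique {m} {n} {σ} {τ} sσ sτ rewrite abs-shiftW m τ =
  Unique.++⁺ (signedPerm-unique sσ) (Unique.map⁺ (λ {x} {y} → ℕ.+-cancelʳ-≡ m x y) (signedPerm-unique sτ)) disjoint
  where
  disjoint : ∀ {k} → ¬ (k ∈ map ∣_∣ σ × k ∈ map (ℕ._+ m) (map ∣_∣ τ))
  disjoint (k∈σ , k∈τ) = ℕ.<⇒≱ (All.lookup above k∈τ) (proj₂ (All.lookup (signedPerm-bounds sσ) k∈σ))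
    where
    above : All (m <_) (map (ℕ._+ m) (map ∣_∣ τ))
    above = All.map⁺ (All.map (λ (0<k , _) → ℕ.m<n+m m 0<k) (signedPerm-bounds sτ))

lemma4p6 : (m n : ℕ) (σ τ : List ℤ) → IsSignedPerm m σ → IsSignedPerm n τ →
           (i j p q : ℕ) → i ℕ.+ j ≤ m → p ℕ.+ q ≤ n →
           Shape m i j σ → Shape n p q τ → (1 < j ⊎ 1 < q) →
           IsZero (φ₂LC (starBar m σ τ))
lemma4p6 m n σ τ sσ sτ i j p q i+j≤m p+q≤n shσ shτ (inj₁ 1<j) =
  star-annihilatingˡ (shiftW m τ) (shape⇒annihilating m i j σ (proj₁ sσ) i+j≤m 1<j shσ) (signedPerms-unique sσ sτ)
lemma4p6 m n σ τ sσ sτ i j p q i+j≤m p+q≤n shσ shτ (inj₂ 1<q) =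
  star-annihilatingʳ σ (annihilating-shiftW m (shape⇒annihilating n p q τ (proj₁ sτ) p+q≤n 1<q shτ)) (signedPerms-unique sσ sτ)
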